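{- Let $T\in\mathcal{T}_3$ have $n$ vertices. Then $\mu(T)<\frac{3n-2}{4}$.
   Context: $\mathcal{T}_3$ is the set of finite trees having at least one internal vertex and in which every internal vertex has degree at least $3$; here a vertex is internal if it has degree at least $2$, and a leaf otherwise. A subtree of $T$ is a nonempty subset $S\subseteq V(T)$ inducing a connected subgraph. $\mu(T)$ is the average number of vertices of a subtree of $T$, the average taken uniformly over all subtrees of $T$. -}

module Defs where

open import Data.Nat using (ℕ; _≤_)
open import Data.Bool using (Bool; true; false)
open import Data.Fin using (Fin)
open import Data.Fin.Subset using (Subset; _∈_; ⊤; ∣_∣; Nonempty)
open import Data.Vec using (tabulate)
open import Data.List using (List; length; _++_; take)
open import Data.List.Relation.Unary.Linked using (Linked)
open import Data.List.Relation.Unary.Unique.Propositional using (Unique)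
open import Data.Product using (_×_; ∃)
open import Relation.Nullary using (¬_)
open import Relation.Binary.PropositionalEquality using (_≡_)

record Graph (n : ℕ) : Set where
  field
    adj    : Fin n → Fin n → Bool
    sym    : ∀ u v → adj u v ≡ adj v u
    irrefl : ∀ v → adj v v ≡ false

open Graph public

module _ {n : ℕ} (G : Graph n) where

  Adj : Fin n → Fin n → Set
  Adj u v = adj G u v ≡ true

  data Reach (S : Subset n) : Fin n → Fin n → Set where
    here : ∀ {u} → u ∈ S → Reach S u u
    step : ∀ {u w v} → Reach S u w → Adj w v → v ∈ S → Reach S u v

  InducesConnected : Subset n → Set
  InducesConnected S = ∀ u v → u ∈ S → v ∈ S → Reach S u v

  Connected : Set
  Connected = InducesConnected ⊤

  IsCycle : List (Fin n) → Set
  IsCycle xs = (3 ≤ length xs) × Unique xs × Linked Adj (xs ++ take 1 xs)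

  Acyclic : Set
  Acyclic = ∀ xs → ¬ IsCycle xs

  IsTree : Set
  IsTree = Connected × Acyclic

  degree : Fin n → ℕ
  degree v = ∣ tabulate (adj G v) ∣

  Internal : Fin n → Set
  Internal v = 2 ≤ degree v

  InT3 : Set
  InT3 = IsTree × (∃ λ v → Internal v) × (∀ v → Internal v → 3 ≤ degree v)

  IsSubtree : Subset n → Set
  IsSubtree S = Nonempty S × InducesConnected S

-- Pair every subtree S with flipLeaves S, which keeps the internal vertices of S (its core)
-- and toggles the membership of each leaf of T adjacent to the core. This is an involution on
-- subtrees, and S and its partner share only internal vertices, so |S| + |flipLeaves S| ≤ n + i,
-- where i is the number of internal vertices. Counting degrees, n + 2i ≤ Σ deg = 2(n − 1), so
-- 2i + 2 ≤ n and hence 2(|S| + |flipLeaves S|) ≤ 3n − 2. Since no two leaves are adjacent, a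
-- subtree without internal vertices is a single leaf, fixed by the flip, and 2(1 + 1) < 3n − 2.
-- Summing over all subtrees counts every size twice: 4 Σ |S| < (3n − 2) · #subtrees.

module Submission where

open import Defs hiding (sym)

open import Data.Bool using (Bool; true; false; not; _∧_; _∨_; _xor_)
open import Data.Bool.Properties using (∧-identityʳ; ∧-zeroʳ; ∨-zeroʳ; ∨-identityʳ; ∨-comm; ∧-conicalˡ; ∧-conicalʳ; T-≡)
open import Data.Empty using (⊥-elim)
open import Data.Fin using (Fin; zero; suc; _≟_)
import Data.Fin.Properties as Fin
open import Data.Fin.Subset using (Subset; ∣_∣; _⊆_; ⊤; ⁅_⁆; Nonempty)
open import Data.Fin.Subset.Properties using (∣p∣≤n; p⊆q⇒∣p∣≤∣q∣; ∈⊤; x∈⁅x⁆; x∈⁅y⁆⇒x≡y; ∣⁅x⁆∣≡1)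
open import Data.List using (List; []; _∷_; length; _++_; map)
open import Data.List.Properties using (map-∘)
open import Data.List.Membership.Propositional.Properties using (∈-map⁺; ∈-map⁻)
open import Data.List.Membership.Propositional.Properties.WithK using (unique∧set⇒bag)
open import Data.List.Relation.Binary.BagAndSetEquality using (∼bag⇒↭)
import Data.List.Relation.Binary.Permutation.Propositional.Properties as ↭
open import Data.List.Relation.Unary.All using (All; []; _∷_)
open import Data.List.Relation.Unary.All.Properties using (All¬⇒¬Any; ¬Any⇒All¬)
open import Data.List.Relation.Unary.AllPairs using ([]; _∷_)
open import Data.List.Relation.Unary.Any using (here; there)
open import Data.List.Relation.Unary.Linked as Linked using (Linked; []; [-]; _∷_)
open import Data.List.Relation.Unary.Unique.Propositional using (Unique)
import Data.List.Relation.Unary.Unique.Propositional.Properties as Unique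
open import Data.Nat using (ℕ; zero; suc; _+_; _*_; _∸_; _≤_; _<_; _≤ᵇ_; z≤n; s≤s)
open import Data.Nat.ListAction using (sum)
open import Data.Nat.ListAction.Properties using (sum-↭)
open import Data.Nat.Properties hiding (_≟_)
open import Algebra.Properties.CommutativeSemigroup +-commutativeSemigroup using (interchange; x∙yz≈y∙xz)
open import Data.Nat.Tactic.RingSolver using (solve-∀)
open import Data.Product using (_×_; _,_; ∃; proj₁; proj₂)
open import Data.Sum using (_⊎_; inj₁; inj₂)
open import Data.Vec using (tabulate; lookup)
open import Data.Vec.Properties using (tabulate-cong; tabulate∘lookup; lookup∘tabulate; []=⇒lookup; lookup⇒[]=)
open import Function using (_∘_; case_of_; Equivalence; mk⇔)
open import Relation.Binary.PropositionalEquality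
open import Relation.Nullary using (¬_; Dec; does; yes; no)
open import Relation.Nullary.Decidable using (dec-true; dec-false)

≤ᵇ≡true⇒≤ : ∀ {m n} → (m ≤ᵇ n) ≡ true → m ≤ n
≤ᵇ≡true⇒≤ {m} {n} m≤ᵇn = ≤ᵇ⇒≤ m n (Equivalence.from T-≡ m≤ᵇn)

≤⇒≤ᵇ≡true : ∀ {m n} → m ≤ n → (m ≤ᵇ n) ≡ true
≤⇒≤ᵇ≡true m≤n = Equivalence.to T-≡ (≤⇒≤ᵇ m≤n)

≤ᵇ≡false⇒> : ∀ {m n} → (m ≤ᵇ n) ≡ false → n < m
≤ᵇ≡false⇒> m≰ᵇn = ≰⇒> λ m≤n → case trans (sym (≤⇒≤ᵇ≡true m≤n)) m≰ᵇn of λ ()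

module Counting where

  open import Data.Fin.Subset using (_∈_)

  𝟙 : Bool → ℕ
  𝟙 true  = 1
  𝟙 false = 0

  ∑ : ∀ {n} → (Fin n → ℕ) → ℕ
  ∑ {zero}  f = 0
  ∑ {suc n} f = f zero + ∑ (f ∘ suc)

  ∑-cong : ∀ {n} {f g : Fin n → ℕ} → f ≗ g → ∑ f ≡ ∑ g
  ∑-cong {zero}  f≗g = refl
  ∑-cong {suc n} f≗g = cong₂ _+_ (f≗g zero) (∑-cong (f≗g ∘ suc))

  ∑-mono-≤ : ∀ {n} {f g : Fin n → ℕ} → (∀ i → f i ≤ g i) → ∑ f ≤ ∑ g
  ∑-mono-≤ {zero}  f≤g = z≤n
  ∑-mono-≤ {suc n} f≤g = +-mono-≤ (f≤g zero) (∑-mono-≤ (f≤g ∘ suc))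

  ∑-distrib-+ : ∀ {n} (f g : Fin n → ℕ) → ∑ (λ i → f i + g i) ≡ ∑ f + ∑ g
  ∑-distrib-+ {zero}  f g = refl
  ∑-distrib-+ {suc n} f g = begin
    (f zero + g zero) + ∑ (λ i → f (suc i) + g (suc i))  ≡⟨ cong ((f zero + g zero) +_) (∑-distrib-+ (f ∘ suc) (g ∘ suc)) ⟩
    (f zero + g zero) + (∑ (f ∘ suc) + ∑ (g ∘ suc))      ≡⟨ interchange (f zero) (g zero) _ _ ⟩
    (f zero + ∑ (f ∘ suc)) + (g zero + ∑ (g ∘ suc))      ∎
    where open ≡-Reasoning

  ∑-const : ∀ {n} c → ∑ {n} (λ _ → c) ≡ n * c
  ∑-const {zero}  c = refl
  ∑-const {suc n} c = cong (c +_) (∑-const {n} c)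

  ∑-*ˡ : ∀ {n} c (f : Fin n → ℕ) → ∑ (λ i → c * f i) ≡ c * ∑ f
  ∑-*ˡ {zero}  c f = sym (*-zeroʳ c)
  ∑-*ˡ {suc n} c f = trans (cong (c * f zero +_) (∑-*ˡ c (f ∘ suc))) (sym (*-distribˡ-+ c (f zero) _))

  ∑-mono-< : ∀ {n} {f g : Fin n → ℕ} a → (∀ i → f i ≤ g i) → f a < g a → ∑ f < ∑ g
  ∑-mono-< {suc n} zero    f≤g fa<ga = +-mono-<-≤ fa<ga (∑-mono-≤ (f≤g ∘ suc))
  ∑-mono-< {suc n} (suc a) f≤g fa<ga = +-mono-≤-< (f≤g zero) (∑-mono-< a (f≤g ∘ suc) fa<ga)

  ∑-point : ∀ {n} (f : Fin n → ℕ) a → f a ≤ ∑ f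
  ∑-point f zero    = m≤m+n _ _
  ∑-point f (suc a) = ≤-trans (∑-point (f ∘ suc) a) (m≤n+m _ _)

  ∑-pair : ∀ {n} (f : Fin n → ℕ) {a b} → a ≢ b → f a + f b ≤ ∑ f
  ∑-pair f {zero}  {zero}  a≢b = ⊥-elim (a≢b refl)
  ∑-pair f {zero}  {suc b} a≢b = +-monoʳ-≤ (f zero) (∑-point (f ∘ suc) b)
  ∑-pair f {suc a} {zero}  a≢b = subst (_≤ ∑ f) (+-comm (f zero) (f (suc a))) (+-monoʳ-≤ (f zero) (∑-point (f ∘ suc) a))
  ∑-pair f {suc a} {suc b} a≢b = ≤-trans (∑-pair (f ∘ suc) (a≢b ∘ cong suc)) (m≤n+m _ _)

  ∑-positive : ∀ {n} (f : Fin n → ℕ) → 0 < ∑ f → ∃ λ i → 0 < f i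
  ∑-positive {suc n} f 0<∑ with f zero in eq
  ... | suc _ = zero , subst (0 <_) (sym eq) (s≤s z≤n)
  ... | zero with ∑-positive (f ∘ suc) 0<∑
  ...   | i , 0<fi = suc i , 0<fi

  ∑-suc-at : ∀ {n} {f g : Fin n → ℕ} a → (∀ i → i ≢ a → f i ≡ g i) → f a ≡ suc (g a) → ∑ f ≡ suc (∑ g)
  ∑-suc-at {suc n} zero    f≡g fa = cong₂ _+_ fa (∑-cong λ i → f≡g (suc i) λ ())
  ∑-suc-at {suc n} (suc a) f≡g fa =
    trans (cong₂ _+_ (f≡g zero λ ()) (∑-suc-at a (λ i i≢a → f≡g (suc i) (i≢a ∘ Fin.suc-injective)) fa)) (+-suc _ _)

  _==_ : ∀ {n} → Fin n → Fin n → Bool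
  i == a = does (i ≟ a)

  ==-refl : ∀ {n} (a : Fin n) → (a == a) ≡ true
  ==-refl a = dec-true (a ≟ a) refl

  ==-≢ : ∀ {n} {i a : Fin n} → i ≢ a → (i == a) ≡ false
  ==-≢ {i = i} {a} = dec-false (i ≟ a)

  ==-false⇒≢ : ∀ {n} {i a : Fin n} → (i == a) ≡ false → i ≢ a
  ==-false⇒≢ {a = a} i==a refl with () ← trans (sym (==-refl a)) i==a

  ∑-δ : ∀ {n} (a : Fin n) → ∑ (λ i → 𝟙 (i == a)) ≡ 1
  ∑-δ {n} a = trans (∑-suc-at {g = λ _ → 0} a (λ i i≢a → cong 𝟙 (==-≢ i≢a)) (cong 𝟙 (==-refl a)))
                    (cong suc (trans (∑-const {n} 0) (*-zeroʳ n)))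

  count : ∀ {n} → (Fin n → Bool) → ℕ
  count f = ∣ tabulate f ∣

  ∈-tabulate⁺ : ∀ {n} {f : Fin n → Bool} {i} → f i ≡ true → i ∈ tabulate f
  ∈-tabulate⁺ {f = f} {i} fi = lookup⇒[]= i (tabulate f) (trans (lookup∘tabulate f i) fi)

  ∈-tabulate⁻ : ∀ {n} {f : Fin n → Bool} {i} → i ∈ tabulate f → f i ≡ true
  ∈-tabulate⁻ {f = f} {i} i∈ = trans (sym (lookup∘tabulate f i)) ([]=⇒lookup i∈)

  count≡∑ : ∀ {n} (f : Fin n → Bool) → count f ≡ ∑ (𝟙 ∘ f)
  count≡∑ {zero}  f = refl
  count≡∑ {suc n} f with f zero
  ... | true  = cong suc (count≡∑ (f ∘ suc))
  ... | false = count≡∑ (f ∘ suc)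

  count≤n : ∀ {n} (f : Fin n → Bool) → count f ≤ n
  count≤n f = ∣p∣≤n (tabulate f)

  count-mono : ∀ {n} {f g : Fin n → Bool} → (∀ i → f i ≡ true → g i ≡ true) → count f ≤ count g
  count-mono {f = f} {g} f⇒g = p⊆q⇒∣p∣≤∣q∣ (λ i∈ → ∈-tabulate⁺ {f = g} (f⇒g _ (∈-tabulate⁻ {f = f} i∈)))

  count-mono-< : ∀ {n} {f g : Fin n → Bool} {a} → (∀ i → f i ≡ true → g i ≡ true) →
                 f a ≡ false → g a ≡ true → count f < count g
  count-mono-< {f = f} {g} {a} f⇒g fa ga =
    subst₂ _<_ (sym (count≡∑ f)) (sym (count≡∑ g)) (∑-mono-< a pointwise (subst₂ _<_ (cong 𝟙 (sym fa)) (cong 𝟙 (sym ga)) ≤-refl))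
    where
    pointwise : ∀ i → 𝟙 (f i) ≤ 𝟙 (g i)
    pointwise i with f i in fi
    ... | true  = ≤-reflexive (cong 𝟙 (sym (f⇒g i fi)))
    ... | false = z≤n

  count-point : ∀ {n} (f : Fin n → Bool) {a} → f a ≡ true → 1 ≤ count f
  count-point f {a} fa = subst₂ _≤_ (cong 𝟙 fa) (sym (count≡∑ f)) (∑-point (𝟙 ∘ f) a)

  count-pair : ∀ {n} (f : Fin n → Bool) {a b} → f a ≡ true → f b ≡ true → a ≢ b → 2 ≤ count f
  count-pair f fa fb a≢b = subst₂ _≤_ (cong₂ _+_ (cong 𝟙 fa) (cong 𝟙 fb)) (sym (count≡∑ f)) (∑-pair (𝟙 ∘ f) a≢b)

  count-positive : ∀ {n} (f : Fin n → Bool) → 1 ≤ count f → ∃ λ i → f i ≡ true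
  count-positive f 1≤ with ∑-positive (𝟙 ∘ f) (subst (1 ≤_) (count≡∑ f) 1≤)
  ... | i , 0<fi with f i in fi
  ...   | true = i , fi

  count≤1⇒unique : ∀ {n} (f : Fin n → Bool) {a b} → count f ≤ 1 → f a ≡ true → f b ≡ true → a ≡ b
  count≤1⇒unique f {a} {b} ≤1 fa fb with a ≟ b
  ... | yes a≡b = a≡b
  ... | no  a≢b = ⊥-elim (<-irrefl refl (≤-trans (count-pair f fa fb a≢b) ≤1))

  count-other : ∀ {n} (f : Fin n → Bool) a → 2 ≤ count f → ∃ λ b → b ≢ a × f b ≡ true
  count-other f a 2≤ = witness (∑-positive (𝟙 ∘ others) (+-cancelˡ-≤ 1 1 _ 2≤1+∑))
    where
    others : Fin _ → Bool
    others i = f i ∧ not (i == a)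

    split : ∀ i → 𝟙 (f i) ≤ 𝟙 (i == a) + 𝟙 (others i)
    split i with f i | i == a
    ... | true  | true  = ≤-refl
    ... | true  | false = ≤-refl
    ... | false | _     = z≤n

    2≤1+∑ : 2 ≤ 1 + ∑ (𝟙 ∘ others)
    2≤1+∑ = begin
      2                                              ≤⟨ 2≤ ⟩
      count f                                        ≡⟨ count≡∑ f ⟩
      ∑ (𝟙 ∘ f)                                      ≤⟨ ∑-mono-≤ split ⟩
      ∑ (λ i → 𝟙 (i == a) + 𝟙 (others i))            ≡⟨ ∑-distrib-+ (λ i → 𝟙 (i == a)) (𝟙 ∘ others) ⟩
      ∑ (λ i → 𝟙 (i == a)) + ∑ (𝟙 ∘ others)          ≡⟨ cong (_+ ∑ (𝟙 ∘ others)) (∑-δ a) ⟩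
      1 + ∑ (𝟙 ∘ others)                             ∎
      where open ≤-Reasoning

    witness : (∃ λ b → 0 < 𝟙 (others b)) → ∃ λ b → b ≢ a × f b ≡ true
    witness (b , _) with f b in fb | b == a in b==a
    witness (b , _) | true | false = b , ==-false⇒≢ b==a , fb

  count-cong : ∀ {n} {f g : Fin n → Bool} → f ≗ g → count f ≡ count g
  count-cong f≗g = cong ∣_∣ (tabulate-cong f≗g)

  count-remove : ∀ {n} (f : Fin n → Bool) {a} → f a ≡ true → count f ≡ suc (count (λ i → f i ∧ not (i == a)))
  count-remove f {a} fa = begin
    count f                                   ≡⟨ count≡∑ f ⟩
    ∑ (𝟙 ∘ f)                                 ≡⟨ ∑-suc-at a agree (trans (cong 𝟙 fa) (cong (suc ∘ 𝟙) (sym removed))) ⟩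
    suc (∑ (λ i → 𝟙 (f i ∧ not (i == a))))    ≡⟨ cong suc (count≡∑ (λ i → f i ∧ not (i == a))) ⟨
    suc (count (λ i → f i ∧ not (i == a)))    ∎
    where
    open ≡-Reasoning
    removed : (f a ∧ not (a == a)) ≡ false
    removed = trans (cong (λ b → f a ∧ not b) (==-refl a)) (∧-zeroʳ (f a))
    agree : ∀ i → i ≢ a → 𝟙 (f i) ≡ 𝟙 (f i ∧ not (i == a))
    agree i i≢a = cong 𝟙 (trans (sym (∧-identityʳ (f i))) (cong (λ b → f i ∧ not b) (sym (==-≢ i≢a))))

  count-+-≤ : ∀ {n} (f g h : Fin n → Bool) → (∀ i → 𝟙 (f i) + 𝟙 (g i) ≤ 1 + 𝟙 (h i)) →
              count f + count g ≤ n + count h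
  count-+-≤ {n} f g h pointwise = begin
    count f + count g                         ≡⟨ cong₂ _+_ (count≡∑ f) (count≡∑ g) ⟩
    ∑ (𝟙 ∘ f) + ∑ (𝟙 ∘ g)                     ≡⟨ ∑-distrib-+ (𝟙 ∘ f) (𝟙 ∘ g) ⟨
    ∑ (λ i → 𝟙 (f i) + 𝟙 (g i))               ≤⟨ ∑-mono-≤ pointwise ⟩
    ∑ (λ i → 1 + 𝟙 (h i))                     ≡⟨ ∑-distrib-+ (λ _ → 1) (𝟙 ∘ h) ⟩
    ∑ {n} (λ _ → 1) + ∑ (𝟙 ∘ h)               ≡⟨ cong₂ _+_ (trans (∑-const {n} 1) (*-identityʳ n)) (sym (count≡∑ h)) ⟩
    n + count h                               ∎
    where open ≤-Reasoning

  any : ∀ {n} → (Fin n → Bool) → Bool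
  any {zero}  f = false
  any {suc n} f = f zero ∨ any (f ∘ suc)

  any-witness : ∀ {n} (f : Fin n → Bool) → any f ≡ true → ∃ λ i → f i ≡ true
  any-witness {suc n} f any≡ with f zero in f0
  ... | true  = zero , f0
  ... | false with any-witness (f ∘ suc) any≡
  ...   | i , fi = suc i , fi

  any-intro : ∀ {n} (f : Fin n → Bool) {i} → f i ≡ true → any f ≡ true
  any-intro f {zero}  f0 rewrite f0 = refl
  any-intro f {suc i} fi rewrite any-intro (f ∘ suc) fi = ∨-zeroʳ (f zero)

  any-cong : ∀ {n} {f g : Fin n → Bool} → f ≗ g → any f ≡ any g
  any-cong {zero}  f≗g = refl
  any-cong {suc n} f≗g = cong₂ _∨_ (f≗g zero) (any-cong (f≗g ∘ suc))

  any-none : ∀ {n} (f : Fin n → Bool) → any f ≡ false → ∀ i → f i ≡ false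
  any-none f any≡ i with f i in fi
  ... | false = refl
  ... | true  = trans (sym (any-intro f fi)) any≡

module GraphBasics {n : ℕ} (G : Graph n) where

  open import Data.Fin.Subset using (_∈_)

  open Counting

  Adj-sym : ∀ {u v} → Adj G u v → Adj G v u
  Adj-sym {u} {v} u~v = trans (Graph.sym G v u) u~v

  Adj⇒≢ : ∀ {u v} → Adj G u v → u ≢ v
  Adj⇒≢ {u} u~u refl with () ← trans (sym u~u) (Graph.irrefl G u)

  Reach-trans : ∀ {S u v w} → Reach G S u v → Reach G S v w → Reach G S u w
  Reach-trans u→v (here _)          = u→v
  Reach-trans u→v (step v→w w~x x∈) = step (Reach-trans u→v v→w) w~x x∈

  Reach-mono : ∀ {S S′ u v} → S ⊆ S′ → Reach G S u v → Reach G S′ u v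
  Reach-mono S⊆S′ (here u∈)        = here (S⊆S′ u∈)
  Reach-mono S⊆S′ (step u→w w~v v∈) = step (Reach-mono S⊆S′ u→w) w~v (S⊆S′ v∈)

  Reach-end : ∀ {S u v} → Reach G S u v → v ∈ S
  Reach-end (here v∈)     = v∈
  Reach-end (step _ _ v∈) = v∈

  internal? : Fin n → Bool
  internal? v = 2 ≤ᵇ degree G v

  leaf-degree : ∀ {v} → internal? v ≡ false → degree G v ≤ 1
  leaf-degree leaf = ≤-pred (≤ᵇ≡false⇒> leaf)

  leaf-neighbour-unique : ∀ {x a b} → internal? x ≡ false → Adj G x a → Adj G x b → a ≡ b
  leaf-neighbour-unique {x} leaf = count≤1⇒unique (adj G x) (leaf-degree leaf)

module AcyclicGraph {n : ℕ} (G : Graph n) (acyclic : Acyclic G) where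

  open import Data.List.Membership.Propositional using (_∈_; _∉_)
  open import Data.List.Membership.DecPropositional (_≟_ {n}) using (_∈?_)

  open Counting
  open GraphBasics G

  _∈ᵇ_ : Fin n → List (Fin n) → Bool
  v ∈ᵇ []      = false
  v ∈ᵇ (x ∷ p) = (v == x) ∨ (v ∈ᵇ p)

  ∉⇒∈ᵇ≡false : ∀ {v} p → v ∉ p → (v ∈ᵇ p) ≡ false
  ∉⇒∈ᵇ≡false []      v∉ = refl
  ∉⇒∈ᵇ≡false (x ∷ p) v∉ rewrite ==-≢ (v∉ ∘ here) = ∉⇒∈ᵇ≡false p (v∉ ∘ there)

  length≤count : ∀ p → Unique p → length p ≤ count (_∈ᵇ p)
  length≤count []      []           = z≤n
  length≤count (x ∷ p) (x∉p ∷ uniq) = begin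
    suc (length p)                                   ≤⟨ s≤s (length≤count p uniq) ⟩
    suc (count (_∈ᵇ p))                              ≡⟨ cong suc (count-cong drop-x) ⟨
    suc (count (λ i → (i ∈ᵇ (x ∷ p)) ∧ not (i == x))) ≡⟨ count-remove (_∈ᵇ (x ∷ p)) (cong (_∨ (x ∈ᵇ p)) (==-refl x)) ⟨
    count (_∈ᵇ (x ∷ p))                              ∎
    where
    open ≤-Reasoning
    drop-x : ∀ i → ((i ∈ᵇ (x ∷ p)) ∧ not (i == x)) ≡ (i ∈ᵇ p)
    drop-x i with i ≟ x
    ... | yes refl = sym (∉⇒∈ᵇ≡false p (All¬⇒¬Any x∉p))
    ... | no  _    = ∧-identityʳ (i ∈ᵇ p)

  length≤n : ∀ p → Unique p → length p ≤ n
  length≤n p uniq = ≤-trans (length≤count p uniq) (count≤n (_∈ᵇ p))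

  prefixTo : ∀ {c} xs → c ∈ xs → List (Fin n)
  prefixTo (x ∷ xs) (here _)   = x ∷ []
  prefixTo (x ∷ xs) (there c∈) = x ∷ prefixTo xs c∈

  prefixTo-all : ∀ {P : Fin n → Set} {c} xs (c∈ : c ∈ xs) → All P xs → All P (prefixTo xs c∈)
  prefixTo-all (x ∷ xs) (here _)   (px ∷ _)   = px ∷ []
  prefixTo-all (x ∷ xs) (there c∈) (px ∷ pxs) = px ∷ prefixTo-all xs c∈ pxs

  prefixTo-unique : ∀ {c} xs (c∈ : c ∈ xs) → Unique xs → Unique (prefixTo xs c∈)
  prefixTo-unique (x ∷ xs) (here _)   (_   ∷ _)    = [] ∷ []
  prefixTo-unique (x ∷ xs) (there c∈) (x∉ ∷ uniq) = prefixTo-all xs c∈ x∉ ∷ prefixTo-unique xs c∈ uniq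

  prefixTo-nonempty : ∀ {c} xs (c∈ : c ∈ xs) → 1 ≤ length (prefixTo xs c∈)
  prefixTo-nonempty (x ∷ xs) (here _)  = s≤s z≤n
  prefixTo-nonempty (x ∷ xs) (there _) = s≤s z≤n

  prefixTo-linked : ∀ {c z} xs (c∈ : c ∈ xs) → Linked (Adj G) xs → Adj G c z →
                    Linked (Adj G) (prefixTo xs c∈ ++ z ∷ [])
  prefixTo-linked (x ∷ xs)     (here refl)         _          c~z = c~z ∷ [-]
  prefixTo-linked (x ∷ y ∷ ys) (there (here refl)) (x~y ∷ _)  c~z = x~y ∷ c~z ∷ [-]
  prefixTo-linked (x ∷ y ∷ ys) (there (there c∈))  (x~y ∷ l)  c~z = x~y ∷ prefixTo-linked (y ∷ ys) (there c∈) l c~z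

  LeafEdge : Set
  LeafEdge = ∃ λ x → ∃ λ y → internal? x ≡ false × Adj G x y

  -- Walk on from the head a without backtracking until a leaf is reached: revisiting a vertex
  -- would close a cycle, and a path has at most n vertices, so the fuel never runs out.
  extendToLeaf : (fuel : ℕ) → ∀ a b rest → Unique (a ∷ b ∷ rest) → Linked (Adj G) (a ∷ b ∷ rest) →
                 n < fuel + length (a ∷ b ∷ rest) → LeafEdge
  extendToLeaf zero a b rest uniq _ n<len = ⊥-elim (<⇒≱ n<len (length≤n (a ∷ b ∷ rest) uniq))
  extendToLeaf (suc fuel) a b rest uniq linked n<len with internal? a in a-int
  ... | false = a , b , a-int , head-edge linked
    where
    head-edge : ∀ {xs} → Linked (Adj G) (a ∷ b ∷ xs) → Adj G a b
    head-edge (a~b ∷ _) = a~b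
  ... | true with count-other (adj G a) b (≤ᵇ≡true⇒≤ a-int)
  ...   | c , c≢b , a~c with c ∈? (a ∷ b ∷ rest)
  ...     | yes (here c≡a)          = ⊥-elim (Adj⇒≢ a~c (sym c≡a))
  ...     | yes (there (here c≡b))  = ⊥-elim (c≢b c≡b)
  ...     | yes (there (there c∈)) = ⊥-elim (acyclic (a ∷ b ∷ prefixTo rest c∈) cycle)
    where
    cycle : IsCycle G (a ∷ b ∷ prefixTo rest c∈)
    cycle = s≤s (s≤s (prefixTo-nonempty rest c∈))
          , prefixTo-unique (a ∷ b ∷ rest) (there (there c∈)) uniq
          , prefixTo-linked (a ∷ b ∷ rest) (there (there c∈)) linked (Adj-sym a~c)
  ...     | no c∉ = extendToLeaf fuel c a (b ∷ rest) (¬Any⇒All¬ _ c∉ ∷ uniq) (Adj-sym a~c ∷ linked)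
                                 (subst (n <_) (sym (+-suc fuel _)) n<len)

  leaf-edge : ∀ {a b} → Adj G a b → LeafEdge
  leaf-edge {a} {b} a~b = extendToLeaf n a b [] ((Adj⇒≢ a~b ∷ []) ∷ [] ∷ []) (a~b ∷ [-]) (m<m+n n (s≤s z≤n))

module EdgeDeletion {n : ℕ} (G : Graph n) {x y : Fin n} (x~y : Adj G x y) where

  open Counting
  open GraphBasics G

  x≢y : x ≢ y
  x≢y = Adj⇒≢ x~y

  isEdge : Fin n → Fin n → Bool
  isEdge u v = (u == x ∧ v == y) ∨ (v == x ∧ u == y)

  G∖xy : Graph n
  G∖xy = record
    { adj    = λ u v → adj G u v ∧ not (isEdge u v)
    ; sym    = λ u v → cong₂ (λ a e → a ∧ not e) (Graph.sym G u v) (∨-comm (u == x ∧ v == y) (v == x ∧ u == y))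
    ; irrefl = λ u → cong (_∧ not (isEdge u u)) (Graph.irrefl G u)
    }

  G∖xy-⊆ : ∀ {u v} → Adj G∖xy u v → Adj G u v
  G∖xy-⊆ u~v = ∧-conicalˡ _ _ u~v

  G∖xy-acyclic : Acyclic G → Acyclic G∖xy
  G∖xy-acyclic acyclic xs (3≤ , uniq , linked) = acyclic xs (3≤ , uniq , Linked.map G∖xy-⊆ linked)

  degree-G∖xy-≤ : ∀ v → degree G∖xy v ≤ degree G v
  degree-G∖xy-≤ v = count-mono (λ u → G∖xy-⊆ {v} {u})

  private
    row-x : ∀ u → adj G∖xy x u ≡ adj G x u ∧ not (u == y)
    row-x u rewrite ==-refl x | ==-≢ x≢y | ∧-zeroʳ (u == x) | ∨-identityʳ (u == y) = refl

    row-y : ∀ u → adj G∖xy y u ≡ adj G y u ∧ not (u == x)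
    row-y u rewrite ==-refl y | ==-≢ (x≢y ∘ sym) | ∧-identityʳ (u == x) = refl

    row-other : ∀ {v} → v ≢ x → v ≢ y → ∀ u → adj G∖xy v u ≡ adj G v u
    row-other v≢x v≢y u rewrite ==-≢ v≢x | ==-≢ v≢y | ∧-zeroʳ (u == x) = ∧-identityʳ _

    indicators : ∀ {v a b} → (v == x) ≡ a → (v == y) ≡ b →
                 degree G∖xy v + (𝟙 (v == x) + 𝟙 (v == y)) ≡ degree G∖xy v + (𝟙 a + 𝟙 b)
    indicators {v} refl refl = refl

  degree-x : degree G x ≡ suc (degree G∖xy x)
  degree-x = trans (count-remove (adj G x) x~y) (cong suc (count-cong (sym ∘ row-x)))

  degree-y : degree G y ≡ suc (degree G∖xy y)
  degree-y = trans (count-remove (adj G y) (Adj-sym x~y)) (cong suc (count-cong (sym ∘ row-y)))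

  degree-split : ∀ v → degree G v ≡ degree G∖xy v + (𝟙 (v == x) + 𝟙 (v == y))
  degree-split v = by-cases (v ≟ x) (v ≟ y)
    where
    by-cases : Dec (v ≡ x) → Dec (v ≡ y) → degree G v ≡ degree G∖xy v + (𝟙 (v == x) + 𝟙 (v == y))
    by-cases (yes refl) _          = trans degree-x (trans (+-comm 1 _) (sym (indicators (==-refl x) (==-≢ x≢y))))
    by-cases (no v≢x)   (yes refl) = trans degree-y (trans (+-comm 1 _) (sym (indicators (==-≢ v≢x) (==-refl y))))
    by-cases (no v≢x)   (no v≢y)   =
      trans (count-cong (sym ∘ row-other v≢x v≢y)) (trans (sym (+-identityʳ _)) (sym (indicators (==-≢ v≢x) (==-≢ v≢y))))

  degreeSum-G∖xy : ∑ (degree G) ≡ ∑ (degree G∖xy) + 2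
  degreeSum-G∖xy = begin
    ∑ (degree G)                                                         ≡⟨ ∑-cong degree-split ⟩
    ∑ (λ v → degree G∖xy v + (𝟙 (v == x) + 𝟙 (v == y)))                  ≡⟨ ∑-distrib-+ (degree G∖xy) _ ⟩
    ∑ (degree G∖xy) + ∑ (λ v → 𝟙 (v == x) + 𝟙 (v == y))                  ≡⟨ cong (∑ (degree G∖xy) +_) (∑-distrib-+ (λ v → 𝟙 (v == x)) (λ v → 𝟙 (v == y))) ⟩
    ∑ (degree G∖xy) + (∑ (λ v → 𝟙 (v == x)) + ∑ (λ v → 𝟙 (v == y)))      ≡⟨ cong (∑ (degree G∖xy) +_) (cong₂ _+_ (∑-δ x) (∑-δ y)) ⟩
    ∑ (degree G∖xy) + 2                                                  ∎
    where open ≡-Reasoning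

module ForestDegreeSum where

  open Counting

  nonIsolated : ∀ {n} → Graph n → ℕ
  nonIsolated G = count (λ v → 1 ≤ᵇ degree G v)

  private
    suc-pred-mono : ∀ {m n} → m < n → 2 ≤ n → suc (m ∸ 1) ≤ n ∸ 1
    suc-pred-mono {zero}  _   2≤n = ∸-monoˡ-≤ 1 2≤n
    suc-pred-mono {suc m} m<n _   = ∸-monoˡ-≤ 1 m<n

    -- Induction on the degree sum: deleting the edge at a leaf lowers it by 2 and isolates the leaf.
    bounded : ∀ {n} k (G : Graph n) → Acyclic G → ∑ (degree G) ≤ k → ∑ (degree G) ≤ 2 * (nonIsolated G ∸ 1)
    bounded k G acyclic ≤k with ∑ (degree G) in sum≡
    ... | zero  = z≤n
    ... | suc s with ∑-positive (degree G) (subst (0 <_) (sym sum≡) (s≤s z≤n))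
    ...   | v , 0<dv with count-positive (adj G v) 0<dv
    ...     | b , v~b with AcyclicGraph.leaf-edge G acyclic v~b
    ...       | x , y , x-leaf , x~y = inductive-step k (subst (_≤ k) sum≡′ ≤k)
      where
      open GraphBasics G
      open EdgeDeletion G x~y

      sum≡′ : suc s ≡ 2 + ∑ (degree G∖xy)
      sum≡′ = trans (sym sum≡) (trans degreeSum-G∖xy (+-comm _ 2))

      x-isolated : degree G∖xy x ≡ 0
      x-isolated = ≤-antisym (≤-pred (subst (_≤ 1) degree-x (leaf-degree x-leaf))) z≤n

      fewer : nonIsolated G∖xy < nonIsolated G
      fewer = count-mono-< (λ u 1≤d → ≤⇒≤ᵇ≡true (≤-trans (≤ᵇ≡true⇒≤ 1≤d) (degree-G∖xy-≤ u)))
                           (cong (1 ≤ᵇ_) x-isolated)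
                           (≤⇒≤ᵇ≡true (count-point (adj G x) x~y))

      two : 2 ≤ nonIsolated G
      two = count-pair _ (≤⇒≤ᵇ≡true (count-point (adj G x) x~y)) (≤⇒≤ᵇ≡true (count-point (adj G y) (Adj-sym x~y))) x≢y

      inductive-step : ∀ k → 2 + ∑ (degree G∖xy) ≤ k → suc s ≤ 2 * (nonIsolated G ∸ 1)
      inductive-step (suc (suc k)) (s≤s (s≤s ≤k)) = begin
        suc s                                       ≡⟨ sum≡′ ⟩
        2 + ∑ (degree G∖xy)                         ≤⟨ +-monoʳ-≤ 2 (bounded k G∖xy (G∖xy-acyclic acyclic) ≤k) ⟩
        2 + 2 * (nonIsolated G∖xy ∸ 1)              ≡⟨ *-suc 2 _ ⟨
        2 * suc (nonIsolated G∖xy ∸ 1)              ≤⟨ *-monoʳ-≤ 2 (suc-pred-mono fewer two) ⟩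
        2 * (nonIsolated G ∸ 1)                     ∎
        where open ≤-Reasoning

  degreeSum-forest : ∀ {n} (G : Graph n) → Acyclic G → ∑ (degree G) ≤ 2 * (nonIsolated G ∸ 1)
  degreeSum-forest G acyclic = bounded _ G acyclic ≤-refl

module LeafFlip {n : ℕ} (G : Graph n) where

  open import Data.Fin.Subset using (_∈_)

  open Counting
  open GraphBasics G

  inCore : Subset n → Fin n → Bool
  inCore S v = lookup S v ∧ internal? v

  core : Subset n → Subset n
  core S = tabulate (inCore S)

  hasCore : Subset n → Bool
  hasCore S = any (inCore S)

  touchesCore : Subset n → Fin n → Bool
  touchesCore S v = any (λ w → inCore S w ∧ adj G w v)

  -- Leaves not adjacent to the core keep their membership, so that flipLeaves is an involution on all subsets.
  flipped : Subset n → Fin n → Bool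
  flipped S v = inCore S v ∨ (not (internal? v) ∧ (lookup S v xor touchesCore S v))

  flipLeaves : Subset n → Subset n
  flipLeaves S = tabulate (flipped S)

  ∈core⁺ : ∀ {S v} → v ∈ S → internal? v ≡ true → v ∈ core S
  ∈core⁺ v∈S int = ∈-tabulate⁺ (cong₂ _∧_ ([]=⇒lookup v∈S) int)

  ∈core⇒∈ : ∀ {S v} → v ∈ core S → v ∈ S
  ∈core⇒∈ {S} {v} v∈ = lookup⇒[]= v S (∧-conicalˡ _ _ (∈-tabulate⁻ {f = inCore S} v∈))

  ∈core⇒internal : ∀ {S v} → v ∈ core S → internal? v ≡ true
  ∈core⇒internal {S} {v} v∈ = ∧-conicalʳ (lookup S v) _ (∈-tabulate⁻ {f = inCore S} v∈)

  -- A walk leaving the core can only step onto a leaf, whose unique neighbour is where it came from.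
  reach-from-core : ∀ {S u v} → u ∈ S → internal? u ≡ true → Reach G S u v →
                    (internal? v ≡ true → Reach G (core S) u v) ×
                    (internal? v ≡ false → ∃ λ w → Reach G (core S) u w × Adj G w v)
  reach-from-core u∈S u-int (here _) =
    (λ _ → here (∈core⁺ u∈S u-int)) , (λ u-leaf → case trans (sym u-int) u-leaf of λ ())
  reach-from-core {S} u∈S u-int (step {w = w} u→w w~v v∈S) with reach-from-core u∈S u-int u→w | internal? w in w-int
  ... | to-core , _ | true  = (λ v-int → step (to-core w-int) w~v (∈core⁺ v∈S v-int)) , (λ _ → w , to-core w-int , w~v)
  ... | _ , to-leaf | false with to-leaf w-int
  ...   | w′ , u→w′ , w′~w with leaf-neighbour-unique w-int (Adj-sym w′~w) w~v
  ...     | refl = (λ _ → u→w′) , (λ v-leaf → case trans (sym (∈core⇒internal {S} (Reach-end u→w′))) v-leaf of λ ())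

  inCore-flipLeaves : ∀ S → inCore (flipLeaves S) ≗ inCore S
  inCore-flipLeaves S v rewrite lookup∘tabulate (flipped S) v with lookup S v | internal? v
  ... | true  | true  = refl
  ... | false | true  = refl
  ... | s     | false = trans (∧-zeroʳ _) (sym (∧-zeroʳ s))

  touchesCore-flipLeaves : ∀ S → touchesCore (flipLeaves S) ≗ touchesCore S
  touchesCore-flipLeaves S v = any-cong (λ w → cong (_∧ adj G w v) (inCore-flipLeaves S w))

  flipLeaves-involutive : ∀ S → flipLeaves (flipLeaves S) ≡ S
  flipLeaves-involutive S = trans (tabulate-cong flipped-twice) (tabulate∘lookup S)
    where
    flipped-twice : ∀ v → flipped (flipLeaves S) v ≡ lookup S v
    flipped-twice v rewrite inCore-flipLeaves S v | touchesCore-flipLeaves S v | lookup∘tabulate (flipped S) v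
      with lookup S v | internal? v | touchesCore S v
    ... | true  | true  | _     = refl
    ... | false | true  | _     = refl
    ... | true  | false | true  = refl
    ... | true  | false | false = refl
    ... | false | false | true  = refl
    ... | false | false | false = refl

  flipLeaves-coreless : ∀ S → hasCore S ≡ false → flipLeaves S ≡ S
  flipLeaves-coreless S coreless = trans (tabulate-cong unchanged) (tabulate∘lookup S)
    where
    untouched : ∀ v → touchesCore S v ≡ false
    untouched v with touchesCore S v in touches
    ... | false = refl
    ... | true with any-witness _ touches
    ...   | w , w-core∧adj with () ← trans (sym (∧-conicalˡ _ _ w-core∧adj)) (any-none (inCore S) coreless w)

    unchanged : ∀ v → flipped S v ≡ lookup S v
    unchanged v rewrite untouched v with lookup S v in s | internal? v in i
    ... | true  | true  with () ← trans (sym (cong₂ _∧_ s i)) (any-none (inCore S) coreless v)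
    ... | false | true  = refl
    ... | true  | false = refl
    ... | false | false = refl

  pairSize : Subset n → ℕ
  pairSize S = 2 * (∣ S ∣ + ∣ flipLeaves S ∣)

  module _ {S : Subset n} (subtree : IsSubtree G S) (cored : hasCore S ≡ true) where

    core-element : ∃ λ u → u ∈ core S
    core-element with any-witness (inCore S) cored
    ... | u , u-core = u , ∈-tabulate⁺ u-core

    core-connected : ∀ {u v} → u ∈ core S → v ∈ core S → Reach G (core S) u v
    core-connected {u} {v} u∈ v∈ =
      proj₁ (reach-from-core (∈core⇒∈ u∈) (∈core⇒internal {S} u∈) (proj₂ subtree u v (∈core⇒∈ u∈) (∈core⇒∈ v∈)))
            (∈core⇒internal {S} v∈)

    leaf-touchesCore : ∀ {v} → v ∈ S → internal? v ≡ false → touchesCore S v ≡ true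
    leaf-touchesCore {v} v∈S v-leaf with core-element
    ... | u , u∈ with proj₂ (reach-from-core (∈core⇒∈ u∈) (∈core⇒internal {S} u∈) (proj₂ subtree u v (∈core⇒∈ u∈) v∈S)) v-leaf
    ...   | w , u→w , w~v = any-intro (λ w → inCore S w ∧ adj G w v) (cong₂ _∧_ (∈-tabulate⁻ {f = inCore S} (Reach-end u→w)) w~v)

    core⊆flipLeaves : core S ⊆ flipLeaves S
    core⊆flipLeaves {v} v∈ =
      ∈-tabulate⁺ {f = flipped S} (cong (_∨ (not (internal? v) ∧ (lookup S v xor touchesCore S v))) (∈-tabulate⁻ {f = inCore S} v∈))

    flipLeaves⊆core∪touching : ∀ {v} → v ∈ flipLeaves S → v ∈ core S ⊎ touchesCore S v ≡ true
    flipLeaves⊆core∪touching {v} v∈ with lookup S v in s | internal? v in i | touchesCore S v in t | ∈-tabulate⁻ {f = flipped S} v∈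
    ... | true  | true  | _     | _  = inj₁ (∈-tabulate⁺ (cong₂ _∧_ s i))
    ... | false | true  | _     | ()
    ... | _     | false | true  | _  = inj₂ refl
    ... | true  | false | false | _  with () ← trans (sym (leaf-touchesCore (lookup⇒[]= v S s) i)) t
    ... | false | false | false | ()

    anchored : ∀ {v} → v ∈ flipLeaves S → ∃ λ r → r ∈ core S × Reach G (flipLeaves S) r v × Reach G (flipLeaves S) v r
    anchored {v} v∈ with flipLeaves⊆core∪touching v∈
    ... | inj₁ v∈core  = v , v∈core , here v∈ , here v∈
    ... | inj₂ touches with any-witness _ touches
    ...   | w , w-core∧adj = w , w∈core , step (here (core⊆flipLeaves w∈core)) w~v v∈
                               , step (here v∈) (Adj-sym w~v) (core⊆flipLeaves w∈core)
      where
      w∈core : w ∈ core S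
      w∈core = ∈-tabulate⁺ (∧-conicalˡ _ _ w-core∧adj)
      w~v : Adj G w v
      w~v = ∧-conicalʳ (inCore S w) _ w-core∧adj

    flipLeaves-subtree-cored : IsSubtree G (flipLeaves S)
    flipLeaves-subtree-cored = nonempty , connected
      where
      nonempty : Nonempty (flipLeaves S)
      nonempty = proj₁ core-element , core⊆flipLeaves (proj₂ core-element)
      connected : InducesConnected G (flipLeaves S)
      connected u v u∈ v∈ with anchored u∈ | anchored v∈
      ... | r , r∈ , _ , u→r | r′ , r′∈ , r′→v , _ =
        Reach-trans u→r (Reach-trans (Reach-mono core⊆flipLeaves (core-connected r∈ r′∈)) r′→v)

    flipLeaves-size : ∣ S ∣ + ∣ flipLeaves S ∣ ≤ n + count internal?
    flipLeaves-size = subst (λ k → k + ∣ flipLeaves S ∣ ≤ n + count internal?) (cong ∣_∣ (tabulate∘lookup S))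
                            (count-+-≤ (lookup S) (flipped S) internal? pointwise)
      where
      pointwise : ∀ v → 𝟙 (lookup S v) + 𝟙 (flipped S v) ≤ 1 + 𝟙 (internal? v)
      pointwise v with lookup S v in s | internal? v in i | touchesCore S v in t
      ... | true  | true  | _     = ≤-refl
      ... | false | true  | _     = z≤n
      ... | true  | false | true  = ≤-refl
      ... | true  | false | false with () ← trans (sym (leaf-touchesCore (lookup⇒[]= v S s) i)) t
      ... | false | false | true  = ≤-refl
      ... | false | false | false = z≤n

  flipLeaves-subtree : ∀ {S} → IsSubtree G S → IsSubtree G (flipLeaves S)
  flipLeaves-subtree {S} subtree with hasCore S in cored
  ... | true  = flipLeaves-subtree-cored subtree cored
  ... | false = subst (IsSubtree G) (sym (flipLeaves-coreless S cored)) subtree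

module T3Tree {n : ℕ} (G : Graph n) (t3 : InT3 G) where

  open import Data.Fin.Subset using (_∈_)

  open Counting
  open GraphBasics G
  open LeafFlip G

  private
    connected : Connected G
    connected = proj₁ (proj₁ t3)

    acyclic : Acyclic G
    acyclic = proj₂ (proj₁ t3)

    u₀ : Fin n
    u₀ = proj₁ (proj₁ (proj₂ t3))

    u₀-internal : internal? u₀ ≡ true
    u₀-internal = ≤⇒≤ᵇ≡true (proj₂ (proj₁ (proj₂ t3)))

  #internal : ℕ
  #internal = count internal?

  leaf-neighbour : ∀ {x} → internal? x ≡ false → ∃ λ w → internal? w ≡ true × Adj G w x
  leaf-neighbour {x} x-leaf with proj₂ (reach-from-core ∈⊤ u₀-internal (connected u₀ x ∈⊤ ∈⊤)) x-leaf
  ... | w , u₀→w , w~x = w , ∈core⇒internal {⊤} (Reach-end u₀→w) , w~x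

  leaves-nonadjacent : ∀ {u v} → internal? u ≡ false → internal? v ≡ false → ¬ Adj G u v
  leaves-nonadjacent u-leaf v-leaf u~v with leaf-neighbour u-leaf
  ... | w , w-int , w~u with leaf-neighbour-unique u-leaf (Adj-sym w~u) u~v
  ...   | refl with () ← trans (sym w-int) v-leaf

  degree-lower : ∀ v → 1 + 2 * 𝟙 (internal? v) ≤ degree G v
  degree-lower v with internal? v in v-int
  ... | true  = proj₂ (proj₂ t3) v (≤ᵇ≡true⇒≤ v-int)
  ... | false = count-point (adj G v) (Adj-sym (proj₂ (proj₂ (leaf-neighbour v-int))))

  degreeSum-lower : n + 2 * #internal ≤ ∑ (degree G)
  degreeSum-lower = begin
    n + 2 * #internal                                ≡⟨ cong₂ _+_ (*-identityʳ n) (cong (2 *_) (sym (count≡∑ internal?))) ⟨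
    n * 1 + 2 * ∑ (𝟙 ∘ internal?)                    ≡⟨ cong₂ _+_ (∑-const {n} 1) (∑-*ˡ 2 (𝟙 ∘ internal?)) ⟨
    ∑ {n} (λ _ → 1) + ∑ (λ v → 2 * 𝟙 (internal? v))  ≡⟨ ∑-distrib-+ (λ _ → 1) (λ v → 2 * 𝟙 (internal? v)) ⟨
    ∑ (λ v → 1 + 2 * 𝟙 (internal? v))                ≤⟨ ∑-mono-≤ degree-lower ⟩
    ∑ (degree G)                                     ∎
    where open ≤-Reasoning

  degreeSum-upper : 2 + ∑ (degree G) ≤ 2 * n
  degreeSum-upper = begin
    2 + ∑ (degree G)                               ≤⟨ +-monoʳ-≤ 2 (ForestDegreeSum.degreeSum-forest G acyclic) ⟩
    2 + 2 * (ForestDegreeSum.nonIsolated G ∸ 1)    ≤⟨ +-monoʳ-≤ 2 (*-monoʳ-≤ 2 (∸-monoˡ-≤ 1 (count≤n (λ v → 1 ≤ᵇ degree G v)))) ⟩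
    2 + 2 * (n ∸ 1)                                ≡⟨ *-suc 2 (n ∸ 1) ⟨
    2 * suc (n ∸ 1)                                ≡⟨ cong (2 *_) (suc-∸1 u₀) ⟩
    2 * n                                          ∎
    where
    open ≤-Reasoning
    suc-∸1 : ∀ {m} → Fin m → suc (m ∸ 1) ≡ m
    suc-∸1 {suc m} _ = refl

  #internal-bound : 2 + 2 * #internal ≤ n
  #internal-bound = +-cancelˡ-≤ n (2 + 2 * #internal) n (begin
    n + (2 + 2 * #internal)    ≡⟨ x∙yz≈y∙xz n 2 (2 * #internal) ⟩
    2 + (n + 2 * #internal)    ≤⟨ +-monoʳ-≤ 2 degreeSum-lower ⟩
    2 + ∑ (degree G)           ≤⟨ degreeSum-upper ⟩
    2 * n                      ≡⟨ cong (n +_) (+-identityʳ n) ⟩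
    n + n                      ∎)
    where open ≤-Reasoning

  #internal-positive : 1 ≤ #internal
  #internal-positive = count-point internal? u₀-internal

  leaf : ∃ λ x → internal? x ≡ false
  leaf with count-other (adj G u₀) u₀ (≤ᵇ≡true⇒≤ u₀-internal)
  ... | b , _ , u₀~b with AcyclicGraph.leaf-edge G acyclic u₀~b
  ...   | x , _ , x-leaf , _ = x , x-leaf

  coreless-subtree-size : ∀ {S} → IsSubtree G S → hasCore S ≡ false → ∣ S ∣ ≤ 1
  coreless-subtree-size {S} ((x , x∈S) , connected-S) coreless =
    subst (∣ S ∣ ≤_) (∣⁅x⁆∣≡1 x) (p⊆q⇒∣p∣≤∣q∣ λ {v} v∈S → subst (_∈ ⁅ x ⁆) (walk-trivial (connected-S x v x∈S v∈S)) (x∈⁅x⁆ x))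
    where
    leaf-of-S : ∀ {v} → v ∈ S → internal? v ≡ false
    leaf-of-S {v} v∈S with internal? v in v-int
    ... | false = refl
    ... | true with () ← trans (sym (cong₂ _∧_ ([]=⇒lookup v∈S) v-int)) (any-none (inCore S) coreless v)

    walk-trivial : ∀ {u v} → Reach G S u v → u ≡ v
    walk-trivial (here _)           = refl
    walk-trivial (step u→w w~v v∈S) with () ← leaves-nonadjacent (leaf-of-S (Reach-end u→w)) (leaf-of-S v∈S) w~v

  coreless-subtree : ∃ λ S → IsSubtree G S × hasCore S ≡ false
  coreless-subtree with leaf
  ... | x , x-leaf = ⁅ x ⁆ , ((x , x∈⁅x⁆ x) , connected-x) , coreless
    where
    connected-x : InducesConnected G ⁅ x ⁆
    connected-x u v u∈ v∈ rewrite x∈⁅y⁆⇒x≡y x u∈ | x∈⁅y⁆⇒x≡y x v∈ = here (x∈⁅x⁆ x)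

    coreless : hasCore ⁅ x ⁆ ≡ false
    coreless with hasCore ⁅ x ⁆ in cored
    ... | false = refl
    ... | true with any-witness (inCore ⁅ x ⁆) cored
    ...   | w , w-core with x∈⁅y⁆⇒x≡y x (∈core⇒∈ {⁅ x ⁆} (∈-tabulate⁺ w-core))
    ...     | refl with () ← trans (sym (∈core⇒internal {⁅ x ⁆} (∈-tabulate⁺ w-core))) x-leaf

  private
    4<3n∸2 : 4 < 3 * n ∸ 2
    4<3n∸2 = m+n≤o⇒m≤o∸n 5 (begin
      7              ≤⟨ m≤m+n 7 5 ⟩
      3 * 4          ≤⟨ *-monoʳ-≤ 3 (≤-trans (+-monoʳ-≤ 2 (*-monoʳ-≤ 2 #internal-positive)) #internal-bound) ⟩
      3 * n          ∎)
      where open ≤-Reasoning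

  coreless-pairSize-bound : ∀ {S} → IsSubtree G S → hasCore S ≡ false → pairSize S < 3 * n ∸ 2
  coreless-pairSize-bound {S} subtree coreless = begin-strict
    2 * (∣ S ∣ + ∣ flipLeaves S ∣)  ≡⟨ cong (λ T → 2 * (∣ S ∣ + ∣ T ∣)) (flipLeaves-coreless S coreless) ⟩
    2 * (∣ S ∣ + ∣ S ∣)             ≤⟨ *-monoʳ-≤ 2 (+-mono-≤ ∣S∣≤1 ∣S∣≤1) ⟩
    4                               <⟨ 4<3n∸2 ⟩
    3 * n ∸ 2                       ∎
    where
    open ≤-Reasoning
    ∣S∣≤1 : ∣ S ∣ ≤ 1
    ∣S∣≤1 = coreless-subtree-size subtree coreless

  pairSize-bound : ∀ {S} → IsSubtree G S → pairSize S ≤ 3 * n ∸ 2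
  pairSize-bound {S} subtree with hasCore S in cored
  ... | false = <⇒≤ (coreless-pairSize-bound subtree cored)
  ... | true  = begin
    2 * (∣ S ∣ + ∣ flipLeaves S ∣)  ≤⟨ *-monoʳ-≤ 2 (flipLeaves-size subtree cored) ⟩
    2 * (n + #internal)             ≤⟨ m+n≤o⇒m≤o∸n (2 * (n + #internal)) (begin
      2 * (n + #internal) + 2         ≡⟨ rearrange n #internal ⟩
      2 * n + (2 + 2 * #internal)     ≤⟨ +-monoʳ-≤ (2 * n) #internal-bound ⟩
      2 * n + n                       ≡⟨ +-comm (2 * n) n ⟩
      3 * n                           ∎) ⟩
    3 * n ∸ 2                       ∎
    where
    open ≤-Reasoning
    rearrange : ∀ a b → 2 * (a + b) + 2 ≡ 2 * a + (2 + 2 * b)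
    rearrange = solve-∀

  small-subtree : ∃ λ S → IsSubtree G S × pairSize S < 3 * n ∸ 2
  small-subtree with coreless-subtree
  ... | S , subtree , coreless = S , subtree , coreless-pairSize-bound subtree coreless

module ListSum {A : Set} where

  open import Data.List.Membership.Propositional using (_∈_)

  sum-map-+ : ∀ (f g : A → ℕ) xs → sum (map (λ x → f x + g x) xs) ≡ sum (map f xs) + sum (map g xs)
  sum-map-+ f g []       = refl
  sum-map-+ f g (x ∷ xs) = trans (cong (f x + g x +_) (sum-map-+ f g xs)) (interchange (f x) (g x) _ _)

  sum-map-*ˡ : ∀ k (f : A → ℕ) xs → sum (map (λ x → k * f x) xs) ≡ k * sum (map f xs)
  sum-map-*ˡ k f []       = sym (*-zeroʳ k)
  sum-map-*ˡ k f (x ∷ xs) = trans (cong (k * f x +_) (sum-map-*ˡ k f xs)) (sym (*-distribˡ-+ k (f x) _))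

  sum-map-≤ : ∀ (f : A → ℕ) c xs → (∀ {x} → x ∈ xs → f x ≤ c) → sum (map f xs) ≤ length xs * c
  sum-map-≤ f c []       _   = z≤n
  sum-map-≤ f c (x ∷ xs) f≤c = +-mono-≤ (f≤c (here refl)) (sum-map-≤ f c xs (f≤c ∘ there))

  sum-map-< : ∀ (f : A → ℕ) c xs → (∀ {x} → x ∈ xs → f x ≤ c) → ∀ {y} → y ∈ xs → f y < c → sum (map f xs) < length xs * c
  sum-map-< f c (x ∷ xs) f≤c (here refl) fy<c = +-mono-<-≤ fy<c (sum-map-≤ f c xs (f≤c ∘ there))
  sum-map-< f c (x ∷ xs) f≤c (there y∈)  fy<c = +-mono-≤-< (f≤c (here refl)) (sum-map-< f c xs (f≤c ∘ there) y∈ fy<c)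

  -- An involution preserving xs permutes it.
  sum-map-involution : ∀ (f : A → A) (g : A → ℕ) xs → (∀ x → f (f x) ≡ x) → Unique xs →
                       (∀ {x} → x ∈ xs → f x ∈ xs) → sum (map (g ∘ f) xs) ≡ sum (map g xs)
  sum-map-involution f g xs involutive uniq closed =
    trans (cong sum (map-∘ xs)) (sum-↭ (↭.map⁺ g (∼bag⇒↭ (unique∧set⇒bag (Unique.map⁺ injective uniq) uniq (mk⇔ to from)))))
    where
    injective : ∀ {x y} → f x ≡ f y → x ≡ y
    injective {x} {y} fx≡fy = trans (sym (involutive x)) (trans (cong f fx≡fy) (involutive y))
    to : ∀ {z} → z ∈ map f xs → z ∈ xs
    to z∈ with ∈-map⁻ f z∈
    ... | y , y∈ , refl = closed y∈
    from : ∀ {z} → z ∈ xs → z ∈ map f xs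
    from {z} z∈ = subst (_∈ map f xs) (involutive z) (∈-map⁺ f (closed z∈))

module SubtreePairing {n : ℕ} (G : Graph n) where

  open import Data.List.Membership.Propositional using (_∈_)

  open LeafFlip G
  open ListSum

  sum-pairSize : ∀ L → Unique L → (∀ {S} → S ∈ L → flipLeaves S ∈ L) → sum (map pairSize L) ≡ 4 * sum (map ∣_∣ L)
  sum-pairSize L uniq closed = begin
    sum (map pairSize L)                                     ≡⟨ sum-map-*ˡ 2 (λ S → ∣ S ∣ + ∣ flipLeaves S ∣) L ⟩
    2 * sum (map (λ S → ∣ S ∣ + ∣ flipLeaves S ∣) L)          ≡⟨ cong (2 *_) (sum-map-+ ∣_∣ (∣_∣ ∘ flipLeaves) L) ⟩
    2 * (sum (map ∣_∣ L) + sum (map (∣_∣ ∘ flipLeaves) L))    ≡⟨ cong (λ s → 2 * (sum (map ∣_∣ L) + s)) flip-invariant ⟩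
    2 * (sum (map ∣_∣ L) + sum (map ∣_∣ L))                  ≡⟨ double-double (sum (map ∣_∣ L)) ⟩
    4 * sum (map ∣_∣ L)                                      ∎
    where
    open ≡-Reasoning
    flip-invariant : sum (map (∣_∣ ∘ flipLeaves) L) ≡ sum (map ∣_∣ L)
    flip-invariant = sum-map-involution flipLeaves ∣_∣ L flipLeaves-involutive uniq closed
    double-double : ∀ s → 2 * (s + s) ≡ 4 * s
    double-double = solve-∀

open import Data.List.Membership.Propositional using (_∈_)

lemma2 : (n : ℕ) (G : Graph n) → InT3 G →
    (L : List (Subset n)) → Unique L →
    (∀ S → (S ∈ L → IsSubtree G S) × (IsSubtree G S → S ∈ L)) →
    4 * sum (map ∣_∣ L) < (3 * n ∸ 2) * length L
lemma2 n G t3 L uniq subtrees = begin-strict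
  4 * sum (map ∣_∣ L)        ≡⟨ sum-pairSize L uniq (complete ∘ flipLeaves-subtree ∘ sound) ⟨
  sum (map pairSize L)       <⟨ sum-map-< pairSize (3 * n ∸ 2) L (pairSize-bound ∘ sound) (complete S₀-subtree) S₀-small ⟩
  length L * (3 * n ∸ 2)     ≡⟨ *-comm (length L) (3 * n ∸ 2) ⟩
  (3 * n ∸ 2) * length L     ∎
  where
  open ≤-Reasoning
  open LeafFlip G
  open T3Tree G t3
  open SubtreePairing G
  open ListSum

  sound : ∀ {S} → S ∈ L → IsSubtree G S
  sound {S} = proj₁ (subtrees S)

  complete : ∀ {S} → IsSubtree G S → S ∈ L
  complete {S} = proj₂ (subtrees S)

  S₀-subtree : IsSubtree G (proj₁ small-subtree)
  S₀-subtree = proj₁ (proj₂ small-subtree)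

  S₀-small : pairSize (proj₁ small-subtree) < 3 * n ∸ 2
  S₀-small = proj₂ (proj₂ small-subtree)
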